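{- Let $f:2^V\to\mathbb{R}_+$ be a normalized ($f(\emptyset)=0$) monotone submodular function with $f(\{v\})>0$ for all $v\in V$. Let $\hat S_1,\dots,\hat S_k$ with densities $\lambda_1,\dots,\lambda_k$ be the deletion-variant dense decomposition of $f$, and let $T_1,\dots,T_{k'}$ with densities $\hat\lambda_1,\dots,\hat\lambda_{k'}$ be the contraction-variant dense decomposition of $f$. Then (i) $k'=k$, (ii) $\hat S_i=T_i$ for all $1\le i\le k$, and (iii) $\hat\lambda_i=1/\lambda_i$ for $1\le i\le k$.
   Context: Deletion variant: let $S_0=V$; for $i\ge1$, while $S_{i-1}\neq\emptyset$, let $S_i\subsetneq S_{i-1}$ be the unique minimal set minimizing $\frac{|S_{i-1}|-|S|}{f(S_{i-1})-f(S)}$ over $S\subsetneq S_{i-1}$; set $\hat S_i=S_{i-1}\setminus S_i$ and $\lambda_i=\frac{|S_{i-1}|-|S_i|}{f(S_{i-1})-f(S_i)}$; the process ends when $S_k=\emptyset$. Contraction variant: let $g(X)=f(V)-f(V\setminus X)$, a normalized monotone supermodular function. Let $T_1$ be the unique maximal set maximizing $g(T)/|T|$ over nonempty $T\subseteq V$, with density $\hat\lambda_1$; then contract, i.e. consider $g_{T_1}(A)=g(T_1\cup A)-g(T_1)$ on $V\setminus T_1$, let $T_2$ be its unique maximal densest set with density $\hat\lambda_2$, and continue until $V$ is partitioned into $T_1,\dots,T_{k'}$. -}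

module Defs where

open import Level using (Level; _⊔_) renaming (suc to lsuc)
open import Data.Nat as ℕ using (ℕ; zero; suc; _∸_)
open import Data.Fin using (Fin)
open import Data.Fin.Subset hiding (_-_)
open import Data.Product using (_×_; Σ)
open import Data.Sum using (_⊎_)
open import Relation.Nullary using (¬_)
open import Relation.Binary.Core using (Rel)
open import Relation.Binary.Structures using (IsTotalOrder)
open import Relation.Binary.PropositionalEquality using (_≡_; _≢_)
open import Algebra.Bundles using (CommutativeRing)

-- Ordered fields (the paper works over ℝ, which is an ordered field;
-- agda-stdlib has no reals, so we state the result for an arbitrary
-- ordered field).  Standard axioms: a commutative ring in which every
-- nonzero element has an inverse, 0 ≠ 1, with a total order compatible
-- with + and with products of nonnegatives.  _⁻¹ is total (its value at
-- 0 is unconstrained) and is only ever applied to nonzero elements.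

record OrderedField (c ℓ₁ ℓ₂ : Level) : Set (lsuc (c ⊔ ℓ₁ ⊔ ℓ₂)) where
  field
    commutativeRing : CommutativeRing c ℓ₁
  open CommutativeRing commutativeRing public
  infix 4 _≤_
  infix 8 _⁻¹
  field
    _⁻¹       : Carrier → Carrier
    ⁻¹-inverse : ∀ x → ¬ (x ≈ 0#) → x * (x ⁻¹) ≈ 1#
    0≉1       : ¬ (0# ≈ 1#)
    _≤_       : Rel Carrier ℓ₂
    isTotalOrder : IsTotalOrder _≈_ _≤_
    +-mono-≤  : ∀ {x y} z → x ≤ y → x + z ≤ y + z
    *-nonneg  : ∀ {x y} → 0# ≤ x → 0# ≤ y → 0# ≤ x * y

  infix 4 _<_
  _<_ : Rel Carrier (ℓ₁ ⊔ ℓ₂)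
  x < y = x ≤ y × ¬ (x ≈ y)

  fromℕ : ℕ → Carrier
  fromℕ zero    = 0#
  fromℕ (suc m) = 1# + fromℕ m

module _ {c ℓ₁ ℓ₂} (F : OrderedField c ℓ₁ ℓ₂) {n : ℕ} where
  open OrderedField F

  SetFn : Set c
  SetFn = Subset n → Carrier

  Nonnegative : SetFn → Set ℓ₂
  Nonnegative f = ∀ A → 0# ≤ f A

  Normalized : SetFn → Set ℓ₁
  Normalized f = f ⊥ ≈ 0#

  Monotone : SetFn → Set ℓ₂
  Monotone f = ∀ A B → A ⊆ B → f A ≤ f B

  Submodular : SetFn → Set ℓ₂
  Submodular f = ∀ A B → f (A ∪ B) + f (A ∩ B) ≤ f A + f B

  PositiveSingletons : SetFn → Set (ℓ₁ ⊔ ℓ₂)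
  PositiveSingletons f = ∀ v → 0# < f ⁅ v ⁆

  _⊊_ : Subset n → Subset n → Set
  A ⊊ B = A ⊆ B × A ≢ B

  -- For S ⊊ X the ratio (|X|-|S|)/(f X - f S) is an extended nonnegative
  -- value: +∞ when the denominator f X - f S is 0.  We compare such
  -- ratios a/b ≤ c/d (a,c ≥ 0 numerators, b,d ≥ 0 denominators) as:
  --   b > 0 and a·d ≤ c·b   (finite ≤ anything, by cross-multiplying), or
  --   b = 0 and d = 0       (∞ ≤ ∞).
  delNum : Subset n → Subset n → Carrier
  delNum X S = fromℕ (∣ X ∣ ∸ ∣ S ∣)

  delDen : SetFn → Subset n → Subset n → Carrier
  delDen f X S = f X - f S

  delRatioLe : SetFn → Subset n → Subset n → Subset n → Set (ℓ₁ ⊔ ℓ₂)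
  delRatioLe f X A B =
    (0# < delDen f X A × delNum X A * delDen f X B ≤ delNum X B * delDen f X A)
    ⊎ (delDen f X A ≈ 0# × delDen f X B ≈ 0#)

  DelMinimizer : SetFn → Subset n → Subset n → Set (ℓ₁ ⊔ ℓ₂)
  DelMinimizer f X S = S ⊊ X × (∀ S' → S' ⊊ X → delRatioLe f X S S')

  DelMinimalMinimizer : SetFn → Subset n → Subset n → Set (ℓ₁ ⊔ ℓ₂)
  DelMinimalMinimizer f X S =
    DelMinimizer f X S × (∀ S' → DelMinimizer f X S' → ¬ (S' ⊊ S))

  DelUniqueMinimal : SetFn → Subset n → Subset n → Set (ℓ₁ ⊔ ℓ₂)
  DelUniqueMinimal f X S =
    DelMinimalMinimizer f X S × (∀ S' → DelMinimalMinimizer f X S' → S' ≡ S)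

  -- Deletion decomposition with k parts: sets S 0, …, S k;
  -- Ŝ i = S (i-1) ∖ S i and λ i for 1 ≤ i ≤ k.
  record DeletionDecomposition (f : SetFn) (k : ℕ) (S : ℕ → Subset n)
         (lam : ℕ → Carrier) : Set (c ⊔ ℓ₁ ⊔ ℓ₂) where
    field
      start     : S 0 ≡ ⊤
      running   : ∀ i → i ℕ.< k → S i ≢ ⊥
      step      : ∀ i → i ℕ.< k → DelUniqueMinimal f (S i) (S (suc i))
      density   : ∀ i → i ℕ.< k →
                  lam (suc i) ≈ delNum (S i) (S (suc i)) * (delDen f (S i) (S (suc i))) ⁻¹
      finish    : S k ≡ ⊥

  Shat : (ℕ → Subset n) → ℕ → Subset n
  Shat S i = S (i ∸ 1) ─ S i

  gOf : SetFn → SetFn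
  gOf f X = f ⊤ - f (∁ X)

  contr : SetFn → Subset n → SetFn
  contr g U A = g (U ∪ A) - g U

  cDensity : SetFn → Subset n → Subset n → Carrier
  cDensity g U T = contr g U T * (fromℕ ∣ T ∣) ⁻¹

  Admissible : Subset n → Subset n → Set
  Admissible U T = Nonempty T × T ⊆ ∁ U

  ConMaximizer : SetFn → Subset n → Subset n → Set ℓ₂
  ConMaximizer g U T =
    Admissible U T × (∀ T' → Admissible U T' → cDensity g U T' ≤ cDensity g U T)

  ConMaximalMaximizer : SetFn → Subset n → Subset n → Set ℓ₂
  ConMaximalMaximizer g U T =
    ConMaximizer g U T × (∀ T' → ConMaximizer g U T' → ¬ (T ⊊ T'))

  ConUniqueMaximal : SetFn → Subset n → Subset n → Set ℓ₂
  ConUniqueMaximal g U T =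
    ConMaximalMaximizer g U T × (∀ T' → ConMaximalMaximizer g U T' → T' ≡ T)

  unionUpTo : (ℕ → Subset n) → ℕ → Subset n
  unionUpTo T zero    = ⊥
  unionUpTo T (suc i) = unionUpTo T i ∪ T (suc i)

  record ContractionDecomposition (f : SetFn) (k' : ℕ) (T : ℕ → Subset n)
         (lamHat : ℕ → Carrier) : Set (c ⊔ ℓ₁ ⊔ ℓ₂) where
    field
      running   : ∀ i → i ℕ.< k' → unionUpTo T i ≢ ⊤
      step      : ∀ i → i ℕ.< k' → ConUniqueMaximal (gOf f) (unionUpTo T i) (T (suc i))
      density   : ∀ i → i ℕ.< k' →
                  lamHat (suc i) ≈ cDensity (gOf f) (unionUpTo T i) (T (suc i))
      finish    : unionUpTo T k' ≡ ⊤

-- Once everything outside X has been contracted, the contracted density of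
-- a nonempty T ⊆ X is (f X − f (X ∖ T)) / |T|, the reciprocal of the
-- deletion ratio |X ∖ S| / (f X − f S) of S = X ∖ T.  Monotonicity, positive
-- singletons and normalization give f X > f ∅, so the ratio of S = ∅ is
-- finite and every minimizing ratio is finite and positive.  Hence T ↦ X ∖ T
-- turns the densest sets into the ratio minimizers and reverses inclusion,
-- so the maximal densest set is the complement in X of the minimal
-- minimizer.  By induction, after i steps the contracted set is the
-- complement of S_i, and the two decompositions produce the same parts
-- with reciprocal densities.

module Submission where

open import Level using (Level)
open import Data.Empty using (⊥-elim)
open import Data.Nat as ℕ using (ℕ; zero; suc; _∸_)
import Data.Nat.Properties as ℕₚ
open import Data.Fin.Subset hiding (_-_)
open import Data.Fin.Subset.Properties
  using ( drop-∷-⊆; s⊂s; out⊂in; p⊂q⇒∣p∣<∣q∣; Empty-unique; nonempty?; x∈⁅y⁆⇒x≡y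
        ; x∈p∧x∉q⇒x∈p─q; p─q⊆p; p─⊥≡p; ⊥⊆; ∪-∩-booleanAlgebra)
open import Data.Product using (_×_; _,_; proj₁)
open import Data.Sum using (inj₁; inj₂)
open import Data.Vec using ([]; _∷_; here; there)
open import Function.Bundles using (_⇔_; mk⇔; Equivalence)
open import Relation.Nullary using (¬_; yes; no)
open import Relation.Binary.Definitions using (tri<; tri≈; tri>)
open import Relation.Binary.Structures using (IsTotalOrder)
open import Relation.Binary.PropositionalEquality
  using (_≡_; _≢_; refl; sym; trans; cong; cong₂; subst; ≢-sym; module ≡-Reasoning)
import Algebra.Lattice.Properties.BooleanAlgebra as BooleanAlgebraProperties

open import Defs

private variable n : ℕ

∁-involutive : (p : Subset n) → ∁ (∁ p) ≡ p
∁-involutive {n} = BooleanAlgebraProperties.¬-involutive (∪-∩-booleanAlgebra n)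

∁⊤≡⊥ : ∁ (⊤ {n}) ≡ ⊥
∁⊤≡⊥ {n} = BooleanAlgebraProperties.¬⊤≈⊥ (∪-∩-booleanAlgebra n)

∁⊥≡⊤ : ∁ (⊥ {n}) ≡ ⊤
∁⊥≡⊤ {n} = BooleanAlgebraProperties.¬⊥≈⊤ (∪-∩-booleanAlgebra n)

∁[∁p∪q]≡p─q : (p q : Subset n) → ∁ (∁ p ∪ q) ≡ p ─ q
∁[∁p∪q]≡p─q []            []            = refl
∁[∁p∪q]≡p─q (inside  ∷ p) (inside  ∷ q) = cong (_ ∷_) (∁[∁p∪q]≡p─q p q)
∁[∁p∪q]≡p─q (inside  ∷ p) (outside ∷ q) = cong (_ ∷_) (∁[∁p∪q]≡p─q p q)
∁[∁p∪q]≡p─q (outside ∷ p) (inside  ∷ q) = cong (_ ∷_) (∁[∁p∪q]≡p─q p q)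
∁[∁p∪q]≡p─q (outside ∷ p) (outside ∷ q) = cong (_ ∷_) (∁[∁p∪q]≡p─q p q)

p─[p─q]≡q : {p q : Subset n} → q ⊆ p → p ─ (p ─ q) ≡ q
p─[p─q]≡q {p = []}          {[]}          _   = refl
p─[p─q]≡q {p = inside  ∷ p} {inside  ∷ q} q⊆p = cong (_ ∷_) (p─[p─q]≡q (drop-∷-⊆ q⊆p))
p─[p─q]≡q {p = inside  ∷ p} {outside ∷ q} q⊆p = cong (_ ∷_) (p─[p─q]≡q (drop-∷-⊆ q⊆p))
p─[p─q]≡q {p = outside ∷ p} {outside ∷ q} q⊆p = cong (_ ∷_) (p─[p─q]≡q (drop-∷-⊆ q⊆p))
p─[p─q]≡q {p = outside ∷ p} {inside  ∷ q} q⊆p with q⊆p here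
... | ()

∁p∪[p─q]≡∁q : {p q : Subset n} → q ⊆ p → ∁ p ∪ (p ─ q) ≡ ∁ q
∁p∪[p─q]≡∁q {p = []}          {[]}          _   = refl
∁p∪[p─q]≡∁q {p = inside  ∷ p} {inside  ∷ q} q⊆p = cong (_ ∷_) (∁p∪[p─q]≡∁q (drop-∷-⊆ q⊆p))
∁p∪[p─q]≡∁q {p = inside  ∷ p} {outside ∷ q} q⊆p = cong (_ ∷_) (∁p∪[p─q]≡∁q (drop-∷-⊆ q⊆p))
∁p∪[p─q]≡∁q {p = outside ∷ p} {outside ∷ q} q⊆p = cong (_ ∷_) (∁p∪[p─q]≡∁q (drop-∷-⊆ q⊆p))
∁p∪[p─q]≡∁q {p = outside ∷ p} {inside  ∷ q} q⊆p with q⊆p here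
... | ()

∣p∣≡∣p─q∣+∣q∣ : {p q : Subset n} → q ⊆ p → ∣ p ∣ ≡ ∣ p ─ q ∣ ℕ.+ ∣ q ∣
∣p∣≡∣p─q∣+∣q∣ {p = []}          {[]}          _   = refl
∣p∣≡∣p─q∣+∣q∣ {p = inside  ∷ p} {inside  ∷ q} q⊆p =
  trans (cong suc (∣p∣≡∣p─q∣+∣q∣ (drop-∷-⊆ q⊆p))) (sym (ℕₚ.+-suc _ _))
∣p∣≡∣p─q∣+∣q∣ {p = inside  ∷ p} {outside ∷ q} q⊆p = cong suc (∣p∣≡∣p─q∣+∣q∣ (drop-∷-⊆ q⊆p))
∣p∣≡∣p─q∣+∣q∣ {p = outside ∷ p} {outside ∷ q} q⊆p = ∣p∣≡∣p─q∣+∣q∣ (drop-∷-⊆ q⊆p)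
∣p∣≡∣p─q∣+∣q∣ {p = outside ∷ p} {inside  ∷ q} q⊆p with q⊆p here
... | ()

∣p∣∸∣p─q∣≡∣q∣ : {p q : Subset n} → q ⊆ p → ∣ p ∣ ∸ ∣ p ─ q ∣ ≡ ∣ q ∣
∣p∣∸∣p─q∣≡∣q∣ {p = p} {q} q⊆p =
  trans (cong (_∸ ∣ p ─ q ∣) (∣p∣≡∣p─q∣+∣q∣ q⊆p)) (ℕₚ.m+n∸m≡n ∣ p ─ q ∣ ∣ q ∣)

p⊆q∧p≢q⇒p⊂q : {p q : Subset n} → p ⊆ q → p ≢ q → p ⊂ q
p⊆q∧p≢q⇒p⊂q {p = []}          {[]}          _   p≢q = ⊥-elim (p≢q refl)
p⊆q∧p≢q⇒p⊂q {p = outside ∷ p} {inside  ∷ q} p⊆q _   = out⊂in (drop-∷-⊆ p⊆q)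
p⊆q∧p≢q⇒p⊂q {p = inside  ∷ p} {inside  ∷ q} p⊆q p≢q =
  s⊂s (p⊆q∧p≢q⇒p⊂q (drop-∷-⊆ p⊆q) (λ p≡q → p≢q (cong (_ ∷_) p≡q)))
p⊆q∧p≢q⇒p⊂q {p = outside ∷ p} {outside ∷ q} p⊆q p≢q =
  s⊂s (p⊆q∧p≢q⇒p⊂q (drop-∷-⊆ p⊆q) (λ p≡q → p≢q (cong (_ ∷_) p≡q)))
p⊆q∧p≢q⇒p⊂q {p = inside  ∷ p} {outside ∷ q} p⊆q _ with p⊆q here
... | ()

x∈p─q⇒x∉q : ∀ {x} (p q : Subset n) → x ∈ p ─ q → x ∉ q
x∈p─q⇒x∉q (_ ∷ p) (inside  ∷ q) ()         here
x∈p─q⇒x∉q (_ ∷ p) (outside ∷ q) here       ()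
x∈p─q⇒x∉q (_ ∷ p) (_       ∷ q) (there x∈) (there x∈q) = x∈p─q⇒x∉q p q x∈ x∈q

p─q≢p : {p q : Subset n} → Nonempty q → q ⊆ p → p ─ q ≢ p
p─q≢p {p = p} {q} (x , x∈q) q⊆p p─q≡p =
  x∈p─q⇒x∉q p q (subst (x ∈_) (sym p─q≡p) (q⊆p x∈q)) x∈q

q⊆p∧q≢p⇒Nonempty[p─q] : {p q : Subset n} → q ⊆ p → q ≢ p → Nonempty (p ─ q)
q⊆p∧q≢p⇒Nonempty[p─q] q⊆p q≢p with p⊆q∧p≢q⇒p⊂q q⊆p q≢p
... | _ , x , x∈p , x∉q = x , x∈p∧x∉q⇒x∈p─q x∈p x∉q

p≢⊥⇒Nonempty : {p : Subset n} → p ≢ ⊥ → Nonempty p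
p≢⊥⇒Nonempty {p = p} p≢⊥ with nonempty? p
... | yes nonempty = nonempty
... | no  empty    = ⊥-elim (p≢⊥ (Empty-unique empty))

x∈p⇒⁅x⁆⊆p : ∀ {x} {p : Subset n} → x ∈ p → ⁅ x ⁆ ⊆ p
x∈p⇒⁅x⁆⊆p {x = x} x∈p y∈⁅x⁆ = subst (_∈ _) (sym (x∈⁅y⁆⇒x≡y x y∈⁅x⁆)) x∈p

r⊊p─q⇒q⊊p─r : {p q r : Subset n} → q ⊆ p → r ⊆ p ─ q → r ≢ p ─ q →
               q ⊆ p ─ r × q ≢ p ─ r
r⊊p─q⇒q⊊p─r {p = p} {q} {r} q⊆p r⊆p─q r≢p─q = q⊆p─r , q≢p─r
  where
  q⊆p─r : q ⊆ p ─ r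
  q⊆p─r x∈q = x∈p∧x∉q⇒x∈p─q (q⊆p x∈q) (λ x∈r → x∈p─q⇒x∉q p q (r⊆p─q x∈r) x∈q)
  q≢p─r : q ≢ p ─ r
  q≢p─r q≡p─r = r≢p─q (sym (trans (cong (p ─_) q≡p─r)
                                  (p─[p─q]≡q (λ x∈r → p─q⊆p p q (r⊆p─q x∈r)))))

module OrderedFieldProperties {c ℓ₁ ℓ₂} (F : OrderedField c ℓ₁ ℓ₂) where

  open OrderedField F hiding (refl) renaming (sym to ≈-sym; trans to ≈-trans)
  open IsTotalOrder isTotalOrder
    using (total; antisym; ≤-respˡ-≈; ≤-respʳ-≈)
    renaming (refl to ≤-refl; trans to ≤-trans)
  open import Algebra.Properties.Ring ring using (-1*x≈-x; -‿involutive; -‿distribˡ-*; -‿distribʳ-*)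
  open import Algebra.Properties.AbelianGroup +-abelianGroup
    using (//-rightDividesˡ; \\-leftDividesʳ; ⁻¹-anti-homo‿-)
  open import Relation.Binary.Reasoning.Setoid setoid

  x≤y⇒0≤y-x : ∀ {x y} → x ≤ y → 0# ≤ y - x
  x≤y⇒0≤y-x {x} x≤y = ≤-respˡ-≈ (-‿inverseʳ x) (+-mono-≤ (- x) x≤y)

  0≤y-x⇒x≤y : ∀ {x y} → 0# ≤ y - x → x ≤ y
  0≤y-x⇒x≤y {x} {y} 0≤y-x =
    ≤-respʳ-≈ (//-rightDividesˡ x y) (≤-respˡ-≈ (+-identityˡ x) (+-mono-≤ x 0≤y-x))

  [x-y]-[x-z]≈z-y : ∀ x y z → (x - y) - (x - z) ≈ z - y
  [x-y]-[x-z]≈z-y x y z = begin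
    (x - y) - (x - z)     ≈⟨ +-congˡ (⁻¹-anti-homo‿- x z) ⟩
    (x - y) + (z - x)     ≈⟨ +-comm (x - y) (z - x) ⟩
    (z - x) + (x - y)     ≈⟨ +-assoc z (- x) (x - y) ⟩
    z + (- x + (x - y))   ≈⟨ +-congˡ (\\-leftDividesʳ x (- y)) ⟩
    z - y                 ∎

  x≤0⇒0≤-x : ∀ {x} → x ≤ 0# → 0# ≤ - x
  x≤0⇒0≤-x {x} x≤0 = ≤-respʳ-≈ (+-identityˡ (- x)) (x≤y⇒0≤y-x x≤0)

  *-monoʳ-≤ : ∀ {x y z} → 0# ≤ z → x ≤ y → x * z ≤ y * z
  *-monoʳ-≤ {x} {y} {z} 0≤z x≤y = 0≤y-x⇒x≤y (≤-respʳ-≈ expand (*-nonneg (x≤y⇒0≤y-x x≤y) 0≤z))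
    where
    expand : (y - x) * z ≈ y * z - x * z
    expand = ≈-trans (distribʳ z y (- x)) (+-congˡ (≈-sym (-‿distribˡ-* x z)))

  0≤1 : 0# ≤ 1#
  0≤1 with total 0# 1#
  ... | inj₁ 0≤1 = 0≤1
  ... | inj₂ 1≤0 = ⊥-elim (0≉1 (antisym (≤-respʳ-≈ -1*-1≈1 (*-nonneg 0≤-1 0≤-1)) 1≤0))
    where
    0≤-1 : 0# ≤ - 1#
    0≤-1 = x≤0⇒0≤-x 1≤0
    -1*-1≈1 : - 1# * - 1# ≈ 1#
    -1*-1≈1 = ≈-trans (-1*x≈-x (- 1#)) (-‿involutive 1#)

  <-≤-trans : ∀ {x y z} → x < y → y ≤ z → x < z
  <-≤-trans (x≤y , x≉y) y≤z =
    ≤-trans x≤y y≤z , λ x≈z → x≉y (antisym x≤y (≤-respʳ-≈ (≈-sym x≈z) y≤z))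

  <-respʳ-≈ : ∀ {x y z} → y ≈ z → x < y → x < z
  <-respʳ-≈ y≈z x<y = <-≤-trans x<y (≤-respʳ-≈ y≈z ≤-refl)

  0<⇒≉0 : ∀ {x} → 0# < x → ¬ (x ≈ 0#)
  0<⇒≉0 (_ , 0≉x) x≈0 = 0≉x (≈-sym x≈0)

  ⁻¹-inverseˡ : ∀ {x} → ¬ (x ≈ 0#) → x ⁻¹ * x ≈ 1#
  ⁻¹-inverseˡ {x} x≉0 = ≈-trans (*-comm (x ⁻¹) x) (⁻¹-inverse x x≉0)

  ⁻¹-unique : ∀ {x y z} → ¬ (x ≈ 0#) → x * y ≈ z → y ≈ x ⁻¹ * z
  ⁻¹-unique {x} {y} {z} x≉0 xy≈z = begin
    y              ≈⟨ *-identityˡ y ⟨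
    1# * y         ≈⟨ *-congʳ (⁻¹-inverseˡ x≉0) ⟨
    x ⁻¹ * x * y   ≈⟨ *-assoc (x ⁻¹) x y ⟩
    x ⁻¹ * (x * y) ≈⟨ *-congˡ xy≈z ⟩
    x ⁻¹ * z       ∎

  ⁻¹-cong : ∀ {x y} → ¬ (x ≈ 0#) → x ≈ y → x ⁻¹ ≈ y ⁻¹
  ⁻¹-cong {x} {y} x≉0 x≈y = ≈-trans (⁻¹-unique y≉0 y*x⁻¹≈1) (*-identityʳ (y ⁻¹))
    where
    y≉0 : ¬ (y ≈ 0#)
    y≉0 y≈0 = x≉0 (≈-trans x≈y y≈0)
    y*x⁻¹≈1 : y * x ⁻¹ ≈ 1#
    y*x⁻¹≈1 = ≈-trans (*-congʳ (≈-sym x≈y)) (⁻¹-inverse x x≉0)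

  *-pos : ∀ {x y} → 0# < x → 0# < y → 0# < x * y
  *-pos {x} {y} 0<x 0<y = *-nonneg (proj₁ 0<x) (proj₁ 0<y) , λ 0≈xy →
    0<⇒≉0 0<y (≈-trans (⁻¹-unique (0<⇒≉0 0<x) (≈-sym 0≈xy)) (zeroʳ (x ⁻¹)))

  ⁻¹-pos : ∀ {x} → 0# < x → 0# < x ⁻¹
  ⁻¹-pos {x} 0<x with total 0# (x ⁻¹)
  ... | inj₁ 0≤x⁻¹ = 0≤x⁻¹ , λ 0≈x⁻¹ →
    0≉1 (≈-trans (≈-sym (zeroʳ x)) (≈-trans (*-congˡ 0≈x⁻¹) (⁻¹-inverse x (0<⇒≉0 0<x))))
  ... | inj₂ x⁻¹≤0 = ⊥-elim (0≉1 (antisym 0≤1 1≤0))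
    where
    x*-x⁻¹≈-1 : x * - (x ⁻¹) ≈ - 1#
    x*-x⁻¹≈-1 = ≈-trans (≈-sym (-‿distribʳ-* x (x ⁻¹))) (-‿cong (⁻¹-inverse x (0<⇒≉0 0<x)))
    1≤0 : 1# ≤ 0#
    1≤0 = 0≤y-x⇒x≤y (≤-respʳ-≈ (≈-sym (+-identityˡ (- 1#)))
            (≤-respʳ-≈ x*-x⁻¹≈-1 (*-nonneg (proj₁ 0<x) (x≤0⇒0≤-x x⁻¹≤0))))

  *-cancelʳ-≤ : ∀ {x y z} → 0# < z → x * z ≤ y * z → x ≤ y
  *-cancelʳ-≤ {x} {y} {z} 0<z xz≤yz =
    ≤-respˡ-≈ (cancel x) (≤-respʳ-≈ (cancel y) (*-monoʳ-≤ (proj₁ (⁻¹-pos 0<z)) xz≤yz))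
    where
    cancel : ∀ u → u * z * z ⁻¹ ≈ u
    cancel u = begin
      u * z * z ⁻¹   ≈⟨ *-assoc u z (z ⁻¹) ⟩
      u * (z * z ⁻¹) ≈⟨ *-congˡ (⁻¹-inverse z (0<⇒≉0 0<z)) ⟩
      u * 1#         ≈⟨ *-identityʳ u ⟩
      u              ∎

  quotient-*-cancel : ∀ {x y z} → ¬ (y ≈ 0#) → x * y ⁻¹ * (y * z) ≈ x * z
  quotient-*-cancel {x} {y} {z} y≉0 = begin
    x * y ⁻¹ * (y * z)    ≈⟨ *-assoc x (y ⁻¹) (y * z) ⟩
    x * (y ⁻¹ * (y * z))  ≈⟨ *-congˡ (*-assoc (y ⁻¹) y z) ⟨
    x * (y ⁻¹ * y * z)    ≈⟨ *-congˡ (*-congʳ (⁻¹-inverseˡ y≉0)) ⟩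
    x * (1# * z)          ≈⟨ *-congˡ (*-identityˡ z) ⟩
    x * z                 ∎

  quotient-pos : ∀ {x y} → 0# < x → 0# < y → 0# < x * y ⁻¹
  quotient-pos 0<x 0<y = *-pos 0<x (⁻¹-pos 0<y)

  quotient-pos⇒numerator-pos : ∀ {x y} → 0# < y → 0# < x * y ⁻¹ → 0# < x
  quotient-pos⇒numerator-pos {x} {y} 0<y 0<x/y = <-respʳ-≈ x/y*y≈x (*-pos 0<x/y 0<y)
    where
    x/y*y≈x : x * y ⁻¹ * y ≈ x
    x/y*y≈x = begin
      x * y ⁻¹ * y    ≈⟨ *-assoc x (y ⁻¹) y ⟩
      x * (y ⁻¹ * y)  ≈⟨ *-congˡ (⁻¹-inverseˡ (0<⇒≉0 0<y)) ⟩
      x * 1#          ≈⟨ *-identityʳ x ⟩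
      x               ∎

  quotient-⁻¹ : ∀ {x y} → 0# < x → 0# < y → (x * y ⁻¹) ⁻¹ ≈ y * x ⁻¹
  quotient-⁻¹ {x} {y} 0<x 0<y = ≈-sym (≈-trans
    (⁻¹-unique (0<⇒≉0 (quotient-pos 0<x 0<y))
               (≈-trans (quotient-*-cancel (0<⇒≉0 0<y)) (⁻¹-inverse x (0<⇒≉0 0<x))))
    (*-identityʳ _))

  quotient-≤⇔cross-≤ : ∀ {x y z w} → 0# < y → 0# < w → (x * y ⁻¹ ≤ z * w ⁻¹ ⇔ w * x ≤ y * z)
  quotient-≤⇔cross-≤ {x} {y} {z} {w} 0<y 0<w = mk⇔
    (λ x/y≤z/w → ≤-respˡ-≈ left (≤-respʳ-≈ right (*-monoʳ-≤ (proj₁ (*-pos 0<y 0<w)) x/y≤z/w)))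
    (λ wx≤yz → *-cancelʳ-≤ (*-pos 0<y 0<w) (≤-respˡ-≈ (≈-sym left) (≤-respʳ-≈ (≈-sym right) wx≤yz)))
    where
    left : x * y ⁻¹ * (y * w) ≈ w * x
    left = ≈-trans (quotient-*-cancel (0<⇒≉0 0<y)) (*-comm x w)
    right : z * w ⁻¹ * (y * w) ≈ y * z
    right = ≈-trans (*-congˡ (*-comm y w)) (≈-trans (quotient-*-cancel (0<⇒≉0 0<w)) (*-comm z y))

  fromℕ-nonneg : ∀ m → 0# ≤ fromℕ m
  1≤fromℕ[1+m] : ∀ m → 1# ≤ fromℕ (suc m)

  fromℕ-nonneg zero    = ≤-refl
  fromℕ-nonneg (suc m) = ≤-trans 0≤1 (1≤fromℕ[1+m] m)

  1≤fromℕ[1+m] m =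
    ≤-respˡ-≈ (+-identityˡ 1#) (≤-respʳ-≈ (+-comm (fromℕ m) 1#) (+-mono-≤ 1# (fromℕ-nonneg m)))

  fromℕ-pos : ∀ {m} → 0 ℕ.< m → 0# < fromℕ m
  fromℕ-pos {suc m} _ = <-≤-trans (0≤1 , 0≉1) (1≤fromℕ[1+m] m)

module DeletionContractionDuality
  {c ℓ₁ ℓ₂} (F : OrderedField c ℓ₁ ℓ₂) {n : ℕ} (f : Subset n → OrderedField.Carrier F)
  (normalized : Normalized F f) (monotone : Monotone F f) (positive : PositiveSingletons F f)
  where

  open OrderedField F hiding (refl) renaming (sym to ≈-sym; trans to ≈-trans; reflexive to ≈-reflexive)
  open IsTotalOrder isTotalOrder using (≤-respˡ-≈; ≤-respʳ-≈)
  open OrderedFieldProperties F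
  open import Algebra.Properties.Ring ring using (-0#≈0#)
  open import Relation.Binary.Reasoning.Setoid setoid

  private variable X S T : Subset n

  g : Subset n → Carrier
  g = gOf F f

  num den : Subset n → Subset n → Carrier
  num = delNum F
  den = delDen F f

  density : Subset n → Subset n → Carrier
  density X = cDensity F g (∁ X)

  0<f : X ≢ ⊥ → 0# < f X
  0<f X≢⊥ with p≢⊥⇒Nonempty X≢⊥
  ... | x , x∈X = <-≤-trans (positive x) (monotone ⁅ x ⁆ _ (x∈p⇒⁅x⁆⊆p x∈X))

  0<den[X,⊥] : X ≢ ⊥ → 0# < den X ⊥
  0<den[X,⊥] {X} X≢⊥ = <-respʳ-≈ fX≈fX-f⊥ (0<f X≢⊥)
    where
    fX≈fX-f⊥ : f X ≈ f X - f ⊥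
    fX≈fX-f⊥ = ≈-sym (≈-trans (+-congˡ (≈-trans (-‿cong normalized) -0#≈0#)) (+-identityʳ (f X)))

  0<num : S ⊆ X → S ≢ X → 0# < num X S
  0<num S⊆X S≢X = fromℕ-pos (ℕₚ.m<n⇒0<n∸m (p⊂q⇒∣p∣<∣q∣ (p⊆q∧p≢q⇒p⊂q S⊆X S≢X)))

  density≈den/num : T ⊆ X → density X T ≈ den X (X ─ T) * num X (X ─ T) ⁻¹
  density≈den/num {T} {X} T⊆X = *-cong gain
    (≈-reflexive (cong (λ m → fromℕ m ⁻¹) (sym (∣p∣∸∣p─q∣≡∣q∣ T⊆X))))
    where
    gain : contr F g (∁ X) T ≈ f X - f (X ─ T)
    gain = begin
      (f ⊤ - f (∁ (∁ X ∪ T))) - (f ⊤ - f (∁ (∁ X)))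
        ≡⟨ cong₂ (λ A B → (f ⊤ - f A) - (f ⊤ - f B)) (∁[∁p∪q]≡p─q X T) (∁-involutive X) ⟩
      (f ⊤ - f (X ─ T)) - (f ⊤ - f X)
        ≈⟨ [x-y]-[x-z]≈z-y (f ⊤) (f (X ─ T)) (f X) ⟩
      f X - f (X ─ T) ∎

  density[X─S]≈den/num : S ⊆ X → density X (X ─ S) ≈ den X S * num X S ⁻¹
  density[X─S]≈den/num {S} {X} S⊆X =
    subst (λ R → density X (X ─ S) ≈ den X R * num X R ⁻¹) (p─[p─q]≡q S⊆X) (density≈den/num (p─q⊆p X S))

  0<density[X,X] : X ≢ ⊥ → 0# < density X X
  0<density[X,X] {X} X≢⊥ = subst (λ R → 0# < density X R) (p─⊥≡p X)
    (<-respʳ-≈ (≈-sym (density[X─S]≈den/num ⊥⊆))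
      (quotient-pos (0<den[X,⊥] X≢⊥) (0<num ⊥⊆ (≢-sym X≢⊥))))

  minimizer⇒0<den : X ≢ ⊥ → DelMinimizer F f X S → 0# < den X S
  minimizer⇒0<den {X} X≢⊥ (_ , minimal) with minimal ⊥ (⊥⊆ , λ ⊥≡X → X≢⊥ (sym ⊥≡X))
  ... | inj₁ (0<den , _) = 0<den
  ... | inj₂ (_ , den[X,⊥]≈0) = ⊥-elim (0<⇒≉0 (0<den[X,⊥] X≢⊥) den[X,⊥]≈0)

  -- Once den X A > 0, the ∞ ≤ ∞ case of delRatioLe cannot occur.
  delRatioLe⇔quotient-≥ : {A B : Subset n} → 0# < den X A → 0# < num X A → 0# < num X B →
                          (delRatioLe F f X A B ⇔ den X B * num X B ⁻¹ ≤ den X A * num X A ⁻¹)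
  delRatioLe⇔quotient-≥ 0<denA 0<numA 0<numB = mk⇔
    (λ { (inj₁ (_ , cross)) → Equivalence.from (quotient-≤⇔cross-≤ 0<numB 0<numA) cross
       ; (inj₂ (denA≈0 , _)) → ⊥-elim (0<⇒≉0 0<denA denA≈0) })
    (λ quotient≤ → inj₁ (0<denA , Equivalence.to (quotient-≤⇔cross-≤ 0<numB 0<numA) quotient≤))

  admissible⇒⊆ : Admissible F (∁ X) T → T ⊆ X
  admissible⇒⊆ {X} (_ , T⊆∁∁X) x∈T = subst (_ ∈_) (∁-involutive X) (T⊆∁∁X x∈T)

  complement-admissible : S ⊆ X → S ≢ X → Admissible F (∁ X) (X ─ S)
  complement-admissible {S} {X} S⊆X S≢X =
    q⊆p∧q≢p⇒Nonempty[p─q] S⊆X S≢X ,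
    λ x∈X─S → subst (_ ∈_) (sym (∁-involutive X)) (p─q⊆p X S x∈X─S)

  maximizer⇒minimizer : X ≢ ⊥ → ConMaximizer F g (∁ X) T → DelMinimizer F f X (X ─ T)
  maximizer⇒minimizer {X} {T} X≢⊥ (admissible@(T≢∅ , _) , densest) =
    (p─q⊆p X T , X─T≢X) , λ S' (S'⊆X , S'≢X) →
      Equivalence.from (delRatioLe⇔quotient-≥ 0<den 0<num[X─T] (0<num S'⊆X S'≢X))
        (≤-respˡ-≈ (density[X─S]≈den/num S'⊆X) (≤-respʳ-≈ (density≈den/num T⊆X)
          (densest (X ─ S') (complement-admissible S'⊆X S'≢X))))
    where
    T⊆X : T ⊆ X
    T⊆X = admissible⇒⊆ admissible
    X─T≢X : X ─ T ≢ X
    X─T≢X = p─q≢p T≢∅ T⊆X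
    0<num[X─T] : 0# < num X (X ─ T)
    0<num[X─T] = 0<num (p─q⊆p X T) X─T≢X
    X-admissible : Admissible F (∁ X) X
    X-admissible = subst (Admissible F (∁ X)) (p─⊥≡p X) (complement-admissible ⊥⊆ (≢-sym X≢⊥))
    0<den : 0# < den X (X ─ T)
    0<den = quotient-pos⇒numerator-pos 0<num[X─T]
      (<-respʳ-≈ (density≈den/num T⊆X) (<-≤-trans (0<density[X,X] X≢⊥) (densest X X-admissible)))

  minimizer⇒maximizer : X ≢ ⊥ → DelMinimizer F f X S → ConMaximizer F g (∁ X) (X ─ S)
  minimizer⇒maximizer {X} {S} X≢⊥ minimizer@((S⊆X , S≢X) , minimal) =
    complement-admissible S⊆X S≢X , λ T' admissible →
      let T'⊆X    = admissible⇒⊆ admissible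
          X─T'≢X = p─q≢p (proj₁ admissible) T'⊆X
      in ≤-respˡ-≈ (≈-sym (density≈den/num T'⊆X)) (≤-respʳ-≈ (≈-sym (density[X─S]≈den/num S⊆X))
           (Equivalence.to (delRatioLe⇔quotient-≥ (minimizer⇒0<den X≢⊥ minimizer) (0<num S⊆X S≢X)
                                                  (0<num (p─q⊆p X T') X─T'≢X))
             (minimal (X ─ T') (p─q⊆p X T' , X─T'≢X))))

  maximal⇒minimal : X ≢ ⊥ → ConMaximalMaximizer F g (∁ X) T → DelMinimalMinimizer F f X (X ─ T)
  maximal⇒minimal X≢⊥ (maximizer@(admissible , _) , maximal) =
    maximizer⇒minimizer X≢⊥ maximizer , λ S minimizer (S⊆X─T , S≢X─T) →
      maximal _ (minimizer⇒maximizer X≢⊥ minimizer)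
        (r⊊p─q⇒q⊊p─r (admissible⇒⊆ admissible) S⊆X─T S≢X─T)

  maximal-maximizer≡complement : X ≢ ⊥ → ConMaximalMaximizer F g (∁ X) T →
                                 DelUniqueMinimal F f X S → T ≡ X ─ S
  maximal-maximizer≡complement {X} {T} X≢⊥ maximal@((admissible , _) , _) (_ , unique) =
    trans (sym (p─[p─q]≡q (admissible⇒⊆ admissible)))
          (cong (X ─_) (unique (X ─ T) (maximal⇒minimal X≢⊥ maximal)))

  density≈deletionRatio⁻¹ : ∀ {λ′} → X ≢ ⊥ → DelMinimizer F f X S →
                            λ′ ≈ num X S * den X S ⁻¹ → density X (X ─ S) ≈ λ′ ⁻¹
  density≈deletionRatio⁻¹ {X} {S} {λ′} X≢⊥ minimizer@((S⊆X , S≢X) , _) λ′≈ratio = begin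
    density X (X ─ S)        ≈⟨ density[X─S]≈den/num S⊆X ⟩
    den X S * num X S ⁻¹     ≈⟨ quotient-⁻¹ 0<num[X,S] 0<den[X,S] ⟨
    (num X S * den X S ⁻¹) ⁻¹ ≈⟨ ⁻¹-cong (0<⇒≉0 (quotient-pos 0<num[X,S] 0<den[X,S])) (≈-sym λ′≈ratio) ⟩
    λ′ ⁻¹                    ∎
    where
    0<num[X,S] : 0# < num X S
    0<num[X,S] = 0<num S⊆X S≢X
    0<den[X,S] : 0# < den X S
    0<den[X,S] = minimizer⇒0<den X≢⊥ minimizer

module DecompositionsAgree
  {c ℓ₁ ℓ₂} (F : OrderedField c ℓ₁ ℓ₂) {n : ℕ} (f : Subset n → OrderedField.Carrier F)
  (normalized : Normalized F f) (monotone : Monotone F f) (positive : PositiveSingletons F f)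
  {k : ℕ} {S : ℕ → Subset n} {lam : ℕ → OrderedField.Carrier F}
  (deletion : DeletionDecomposition F f k S lam)
  {k' : ℕ} {T : ℕ → Subset n} {lamHat : ℕ → OrderedField.Carrier F}
  (contraction : ContractionDecomposition F f k' T lamHat)
  where

  open OrderedField F using (_≈_; _⁻¹; setoid)
  open DeletionContractionDuality F f normalized monotone positive
  import Relation.Binary.Reasoning.Setoid setoid as ≈-Reasoning
  module Del = DeletionDecomposition deletion
  module Con = ContractionDecomposition contraction

  contracted : ℕ → Subset n
  contracted = unionUpTo F T

  part≡deleted : ∀ i → i ℕ.< k → i ℕ.< k' → contracted i ≡ ∁ (S i) → T (suc i) ≡ S i ─ S (suc i)
  part≡deleted i i<k i<k' contracted≡∁S =
    maximal-maximizer≡complement (Del.running i i<k)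
      (proj₁ (subst (λ U → ConUniqueMaximal F g U (T (suc i))) contracted≡∁S (Con.step i i<k')))
      (Del.step i i<k)

  contracted≡∁remaining : ∀ i → i ℕ.≤ k → i ℕ.≤ k' → contracted i ≡ ∁ (S i)
  contracted≡∁remaining zero    _      _       = sym (trans (cong ∁ Del.start) ∁⊤≡⊥)
  contracted≡∁remaining (suc i) 1+i≤k 1+i≤k' =
    trans (cong₂ _∪_ contracted≡∁S (part≡deleted i 1+i≤k 1+i≤k' contracted≡∁S))
          (∁p∪[p─q]≡∁q S[1+i]⊆S[i])
    where
    contracted≡∁S : contracted i ≡ ∁ (S i)
    contracted≡∁S = contracted≡∁remaining i (ℕₚ.<⇒≤ 1+i≤k) (ℕₚ.<⇒≤ 1+i≤k')
    S[1+i]⊆S[i] : S (suc i) ⊆ S i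
    S[1+i]⊆S[i] = proj₁ (proj₁ (proj₁ (proj₁ (Del.step i 1+i≤k))))

  k'≡k : k' ≡ k
  k'≡k with ℕₚ.<-cmp k k'
  ... | tri≈ _ k≡k' _ = sym k≡k'
  ... | tri< k<k' _ _ = ⊥-elim (Con.running k k<k' (begin
    contracted k       ≡⟨ contracted≡∁remaining k ℕₚ.≤-refl (ℕₚ.<⇒≤ k<k') ⟩
    ∁ (S k)            ≡⟨ cong ∁ Del.finish ⟩
    ∁ ⊥                ≡⟨ ∁⊥≡⊤ ⟩
    ⊤                  ∎))
    where open ≡-Reasoning
  ... | tri> _ _ k'<k = ⊥-elim (Del.running k' k'<k (begin
    S k'               ≡⟨ ∁-involutive (S k') ⟨
    ∁ (∁ (S k'))       ≡⟨ cong ∁ (contracted≡∁remaining k' (ℕₚ.<⇒≤ k'<k) ℕₚ.≤-refl) ⟨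
    ∁ (contracted k')  ≡⟨ cong ∁ Con.finish ⟩
    ∁ ⊤                ≡⟨ ∁⊤≡⊥ ⟩
    ⊥                  ∎))
    where open ≡-Reasoning

  parts-agree : ∀ i → 1 ℕ.≤ i → i ℕ.≤ k → Shat F S i ≡ T i × lamHat i ≈ lam i ⁻¹
  parts-agree (suc i) _ i<k = sym T≡ , density≈
    where
    i<k' : i ℕ.< k'
    i<k' = subst (i ℕ.<_) (sym k'≡k) i<k
    contracted≡∁S : contracted i ≡ ∁ (S i)
    contracted≡∁S = contracted≡∁remaining i (ℕₚ.<⇒≤ i<k) (ℕₚ.<⇒≤ i<k')
    T≡ : T (suc i) ≡ S i ─ S (suc i)
    T≡ = part≡deleted i i<k i<k' contracted≡∁S
    density≈ : lamHat (suc i) ≈ lam (suc i) ⁻¹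
    density≈ = begin
      lamHat (suc i)                           ≈⟨ Con.density i i<k' ⟩
      cDensity F g (contracted i) (T (suc i))  ≡⟨ cong₂ (cDensity F g) contracted≡∁S T≡ ⟩
      density (S i) (S i ─ S (suc i))          ≈⟨ density≈deletionRatio⁻¹ (Del.running i i<k)
                                                    (proj₁ (proj₁ (Del.step i i<k))) (Del.density i i<k) ⟩
      lam (suc i) ⁻¹                           ∎
      where open ≈-Reasoning

theorem5 : ∀ {c ℓ₁ ℓ₂ : Level} (F : OrderedField c ℓ₁ ℓ₂) (n : ℕ)
    (f : Subset n → OrderedField.Carrier F) →
    Nonnegative F f → Normalized F f → Monotone F f →
    Submodular F f → PositiveSingletons F f →
    (k : ℕ) (S : ℕ → Subset n) (lam : ℕ → OrderedField.Carrier F) →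
    DeletionDecomposition F f k S lam →
    (k' : ℕ) (T : ℕ → Subset n) (lamHat : ℕ → OrderedField.Carrier F) →
    ContractionDecomposition F f k' T lamHat →
    k' ≡ k × (∀ i → 1 ℕ.≤ i → i ℕ.≤ k →
    Shat F S i ≡ T i × OrderedField._≈_ F (lamHat i) (OrderedField._⁻¹ F (lam i)))
theorem5 F n f _ normalized monotone _ positive k S lam deletion k' T lamHat contraction =
  k'≡k , parts-agree
  where open DecompositionsAgree F f normalized monotone positive deletion contraction
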